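{- For the wheel $W_n$ on $n\ge 4$ vertices, $\sigma^-(W_n)=\lfloor (n+4)/2\rfloor$.
   Context: The wheel $W_n$ is the graph on $n$ vertices obtained by joining one central vertex to every vertex of a cycle $C_{n-1}$ (so $W_n$ is the edge-disjoint union of $K_{1,n-1}$ and $C_{n-1}$). For a graph $G$ with $N$ vertices and a bijection $f:V(G)\to\{1,\dots,N\}$, call an edge $uv$ negative under $f$ if $f(u)$ and $f(v)$ have opposite parity. The rna number $\sigma^-(G)$ is the minimum, over all such bijections $f$, of the number of negative edges under $f$. -}

module Defs where

open import Data.Nat using (ℕ; zero; suc; _+_; _≤_; _/_)
open import Data.Bool using (Bool; true; false; if_then_else_; not)
open import Data.Fin using (Fin; zero; suc; toℕ)
open import Data.Maybe using (Maybe; just; nothing; fromMaybe)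
import Data.Maybe
open import Data.List using (List; []; _∷_; map; length; filter; allFin; _++_)
open import Data.Product using (_×_; _,_; Σ)
open import Function.Bundles using (_⤖_; Bijection)
open import Relation.Binary.PropositionalEquality using (_≡_)
open import Relation.Nullary.Decidable using (Dec; yes; no)
open import Data.Bool using (_≟_)

-- A (simple, undirected) graph on vertex set Fin N is given by its edge list;
-- each edge is an unordered pair, listed once.
record Graph : Set where
  field
    N     : ℕ
    edges : List (Fin N × Fin N)
open Graph public

next : ∀ {k} → Fin k → Maybe (Fin k)
next {suc zero}    zero    = nothing
next {suc (suc k)} zero    = just (suc zero)
next {suc k}       (suc i) = Data.Maybe.map suc (next i)

cyc : ∀ {k} → Fin k → Fin k
cyc {suc k} i = fromMaybe zero (next i)

-- Wheel W_(suc k): vertex zero is the centre, vertices suc i (i : Fin k)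
-- form the cycle C_k with edges  suc i — suc (i+1 mod k).
wheel : ℕ → Graph
wheel zero    = record { N = zero ; edges = [] }
wheel (suc k) = record
  { N     = suc k
  ; edges = map (λ i → (zero , suc i)) (allFin k)
         ++ map (λ i → (suc i , suc (cyc i))) (allFin k) }

even : ℕ → Bool
even zero = true
even (suc n) = not (even n)

-- A labelling is a bijection f : V(G) → {1,…,N}; we represent the label set
-- {1,…,N} by Fin N, where x : Fin N stands for the label toℕ x + 1.
Labelling : Graph → Set
Labelling G = Fin (N G) ⤖ Fin (N G)

label : ∀ {G} → Labelling G → Fin (N G) → ℕ
label f v = suc (toℕ (Bijection.to f v))

isNegative : ∀ {G} → Labelling G → Fin (N G) × Fin (N G) → Bool
isNegative {G} f (u , v) with even (label {G} f u) ≟ even (label {G} f v)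
... | yes _ = false
... | no  _ = true

negCount : ∀ {G} → Labelling G → ℕ
negCount {G} f = length (filter (λ e → isNegative {G} f e ≟ true) (edges G))

IsRna : Graph → ℕ → Set
IsRna G s = Σ (Labelling G) (λ f → negCount {G} f ≡ s) × ((f : Labelling G) → s ≤ negCount {G} f)

module Submission where

-- Only the parities of the labels matter. The spokes contribute the number of labels whose
-- parity differs from the centre's; reindexing this count by the labelling shows that it is
-- ⌊n/2⌋ if the centre's label is odd and ⌈n/2⌉ otherwise. The rim is a cycle, so once both
-- parities occur on it (which they must for n ≥ 4, as the centre takes a single label) its
-- parity changes at least twice. Label 1 at the centre, with the remaining odd labels on one
-- arc of the rim and the even labels on the other, attains ⌊n/2⌋ + 2 = ⌊(n+4)/2⌋.

open import Defs
open import Data.Nat using (ℕ; zero; suc; _≤_; _<_; _+_; _*_; _/_; _<ᵇ_; z≤n; s≤s)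
open import Data.Nat.Properties
  using (+-comm; *-comm; <⇒<ᵇ; m≤m*n; m≤n⇒m≤1+n; n≤1+n; ≤-reflexive; +-mono-≤;
         module ≤-Reasoning; +-0-commutativeMonoid)
open import Data.Nat.DivMod using (m/n≡1+[m∸n]/n; /-monoˡ-≤)
open import Data.Bool using (Bool; true; false; not; _xor_; if_then_else_)
open import Data.Bool.Properties
  using (_≟_; not-involutive; xor-same; xor-inverseˡ; ¬-not; not-¬; T-≡)
open import Data.Fin using (Fin; zero; suc; toℕ; cast; combine; remQuot) renaming (_≟_ to _≟ᶠ_)
open import Data.Fin.Patterns using (0F; 1F; 2F; 3F)
open import Data.Fin.Properties
  using (*↔×; combine-remQuot; toℕ-combine; toℕ-cast; toℕ-↑ˡ; toℕ-↑ʳ; toℕ<n)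
open import Data.Fin.Permutation using (Permutation′; _⟨$⟩ʳ_; cast-id; lift₀)
open import Data.List using (List; []; _∷_; [_]; _++_; map; filter; length; tabulate; applyUpTo; allFin)
open import Data.List.Properties using (filter-++; length-++; map-tabulate)
open import Data.List.Membership.Propositional using (_∈_)
open import Data.List.Membership.Propositional.Properties using (∈-tabulate⁺)
open import Data.List.Relation.Unary.Any using (there)
open import Data.Maybe using (just; nothing; fromMaybe)
import Data.Maybe as Maybe
open import Data.Maybe.Properties using (map-∘)
open import Data.Product using (_×_; _,_; ∃; proj₁; proj₂)
open import Data.Product.Algebra using (×-comm)
open import Function using (_∘_; _⤖_; Bijection; Equivalence)
open import Function.Properties.Bijection using (⤖⇒↔)
open import Function.Properties.Inverse using (↔-trans; ↔-sym; ↔⇒⤖)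
open import Relation.Nullary using (yes; no; contradiction)
open import Relation.Binary.PropositionalEquality
  using (_≡_; _≢_; _≗_; refl; sym; trans; cong; cong₂; subst; module ≡-Reasoning)
import Algebra.Properties.CommutativeMonoid.Sum +-0-commutativeMonoid as Sum

count : ∀ {k} → (Fin k → Bool) → ℕ
count p = Sum.sum (λ i → if p i then 1 else 0)

count-cong : ∀ {k} {p q : Fin k → Bool} → p ≗ q → count p ≡ count q
count-cong p≗q = Sum.sum-cong-≗ (cong (λ b → if b then 1 else 0) ∘ p≗q)

count-permute : ∀ {k} (π : Permutation′ k) (p : Fin k → Bool) → count (p ∘ (π ⟨$⟩ʳ_)) ≡ count p
count-permute π p = sym (Sum.sum-permute _ π)

length-filter-map-allFin : ∀ {A : Set} {k} (p : A → Bool) (g : Fin k → A) →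
  length (filter (λ x → p x ≟ true) (map g (allFin k))) ≡ count (p ∘ g)
length-filter-map-allFin p g =
  trans (cong (λ xs → length (filter (λ x → p x ≟ true) xs)) (map-tabulate (λ i → i) g))
        (length-filter-tabulate g)
  where
  length-filter-tabulate : ∀ {k} (g : Fin k → _) →
    length (filter (λ x → p x ≟ true) (tabulate g)) ≡ count (p ∘ g)
  length-filter-tabulate {zero}  g = refl
  length-filter-tabulate {suc k} g with p (g zero)
  ... | true  = cong suc (length-filter-tabulate (g ∘ suc))
  ... | false = length-filter-tabulate (g ∘ suc)

alternations : Bool → List Bool → ℕ
alternations a []       = 0
alternations a (b ∷ bs) = (if a xor b then 1 else 0) + alternations b bs

cycleFlips : ∀ {k} → (Fin k → Bool) → ℕ
cycleFlips Q = count (λ i → Q i xor Q (cyc i))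

cycleFlips-cong : ∀ {k} {Q Q′ : Fin k → Bool} → Q ≗ Q′ → cycleFlips Q ≡ cycleFlips Q′
cycleFlips-cong Q≗Q′ = count-cong (λ i → cong₂ _xor_ (Q≗Q′ i) (Q≗Q′ (cyc i)))

cycleFlips-not : ∀ {k} (Q : Fin k → Bool) → cycleFlips (not ∘ Q) ≡ cycleFlips Q
cycleFlips-not Q = count-cong (λ i → not-xor-not (Q i) (Q (cyc i)))
  where
  not-xor-not : ∀ a b → not a xor not b ≡ a xor b
  not-xor-not false b = not-involutive b
  not-xor-not true  b = refl

cycleFlips≡alternations : ∀ {m} (Q : Fin (suc m) → Bool) →
  cycleFlips Q ≡ alternations (Q zero) (tabulate (Q ∘ suc) ++ [ Q zero ])
cycleFlips≡alternations Q =
  trans (count-cong (λ i → cong (Q i xor_) (cyc≡wrap Q i))) (walk Q (Q zero))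
  where
  -- `next` marks the last vertex with `nothing`; d stands for the colour the walk returns to.
  wrap : ∀ {m} → (Fin (suc m) → Bool) → Bool → Fin (suc m) → Bool
  wrap Q d i = fromMaybe d (Maybe.map Q (next i))

  cyc≡wrap : ∀ {m} (Q : Fin (suc m) → Bool) i → Q (cyc i) ≡ wrap Q (Q zero) i
  cyc≡wrap Q i with next i
  ... | just _  = refl
  ... | nothing = refl

  walk : ∀ {m} (Q : Fin (suc m) → Bool) d →
    count (λ i → Q i xor wrap Q d i) ≡ alternations (Q zero) (tabulate (Q ∘ suc) ++ [ d ])
  walk {zero}  Q d = refl
  walk {suc m} Q d = cong ((if Q 0F xor Q 1F then 1 else 0) +_) (trans
    (count-cong (λ i → cong (λ x → Q (suc i) xor fromMaybe d x) (sym (map-∘ {g = Q} {f = suc} (next i)))))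
    (walk (Q ∘ suc) d))

1≤alternations-to-not : ∀ a bs → 1 ≤ alternations a (bs ++ [ not a ])
1≤alternations-to-not true  []           = s≤s z≤n
1≤alternations-to-not false []           = s≤s z≤n
1≤alternations-to-not true  (true ∷ bs)  = 1≤alternations-to-not true bs
1≤alternations-to-not true  (false ∷ bs) = s≤s z≤n
1≤alternations-to-not false (true ∷ bs)  = s≤s z≤n
1≤alternations-to-not false (false ∷ bs) = 1≤alternations-to-not false bs

2≤alternations-closed : ∀ {a bs} → not a ∈ bs → 2 ≤ alternations a (bs ++ [ a ])
2≤alternations-closed {true}  {false ∷ bs} _         = s≤s (1≤alternations-to-not false bs)
2≤alternations-closed {false} {true ∷ bs}  _         = s≤s (1≤alternations-to-not true bs)
2≤alternations-closed {true}  {true ∷ bs}  (there p) = 2≤alternations-closed p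
2≤alternations-closed {false} {false ∷ bs} (there p) = 2≤alternations-closed p

2≤cycleFlips : ∀ {m} (Q : Fin (suc m) → Bool) {i} → Q i ≡ not (Q zero) → 2 ≤ cycleFlips Q
2≤cycleFlips Q {zero}  Q₀≡notQ₀ = contradiction Q₀≡notQ₀ (not-¬ refl)
2≤cycleFlips Q {suc i} Qᵢ≡notQ₀ = subst (2 ≤_) (sym (cycleFlips≡alternations Q))
  (2≤alternations-closed (subst (_∈ tabulate (Q ∘ suc)) Qᵢ≡notQ₀ (∈-tabulate⁺ i)))

tabulate-∘toℕ : ∀ {A : Set} (r : ℕ → A) n → tabulate {n = n} (r ∘ toℕ) ≡ applyUpTo r n
tabulate-∘toℕ r zero    = refl
tabulate-∘toℕ r (suc n) = cong (r 0 ∷_) (tabulate-∘toℕ (r ∘ suc) n)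

alternations-threshold : ∀ {t m} → t < m → alternations true (applyUpTo (_<ᵇ t) m ++ [ true ]) ≡ 2
alternations-threshold {zero}  {suc m} _         = cong suc (falseUntilEnd m)
  where
  falseUntilEnd : ∀ m → alternations false (applyUpTo (λ _ → false) m ++ [ true ]) ≡ 1
  falseUntilEnd zero    = refl
  falseUntilEnd (suc m) = falseUntilEnd m
alternations-threshold {suc t} {suc m} (s≤s t<m) = alternations-threshold t<m

cycleFlips-threshold : ∀ {t m} → t < m → cycleFlips {suc m} (λ i → toℕ i <ᵇ suc t) ≡ 2
cycleFlips-threshold {t} {m} t<m = begin
  cycleFlips {suc m} (λ i → toℕ i <ᵇ suc t)
    ≡⟨ cycleFlips≡alternations {m} (λ i → toℕ i <ᵇ suc t) ⟩
  alternations true (tabulate {n = m} ((_<ᵇ t) ∘ toℕ) ++ [ true ])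
    ≡⟨ cong (λ bs → alternations true (bs ++ [ true ])) (tabulate-∘toℕ (_<ᵇ t) m) ⟩
  alternations true (applyUpTo (_<ᵇ t) m ++ [ true ])
    ≡⟨ alternations-threshold t<m ⟩
  2 ∎
  where open ≡-Reasoning

[2+n]/2≡1+n/2 : ∀ n → suc (suc n) / 2 ≡ suc (n / 2)
[2+n]/2≡1+n/2 n = m/n≡1+[m∸n]/n {suc (suc n)} {2} (s≤s (s≤s z≤n))

[n+4]/2≡n/2+2 : ∀ n → (n + 4) / 2 ≡ n / 2 + 2
[n+4]/2≡n/2+2 n = begin
  (n + 4) / 2           ≡⟨ cong (_/ 2) (+-comm n 4) ⟩
  suc (suc (2 + n)) / 2 ≡⟨ [2+n]/2≡1+n/2 (2 + n) ⟩
  suc ((2 + n) / 2)     ≡⟨ cong suc ([2+n]/2≡1+n/2 n) ⟩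
  2 + n / 2             ≡⟨ +-comm 2 (n / 2) ⟩
  n / 2 + 2             ∎
  where open ≡-Reasoning

n<2+n*2 : ∀ n → n < 2 + n * 2
n<2+n*2 n = s≤s (m≤n⇒m≤1+n (m≤m*n n 2))

m+n<ᵇm≡false : ∀ m n → (m + n <ᵇ m) ≡ false
m+n<ᵇm≡false zero    n = refl
m+n<ᵇm≡false (suc m) n = m+n<ᵇm≡false m n

data Halving : ℕ → Set where
  evenly : ∀ h → Halving (h * 2)
  oddly  : ∀ h → Halving (suc (h * 2))

halving : ∀ n → Halving n
halving zero = evenly 0
halving (suc n) with halving n
... | evenly h = oddly h
... | oddly  h = evenly (suc h)

even-m*2+n : ∀ m n → even (m * 2 + n) ≡ even n
even-m*2+n zero    n = refl
even-m*2+n (suc m) n = trans (not-involutive (even (m * 2 + n))) (even-m*2+n m n)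

parityMismatches : Bool → ℕ → ℕ
parityMismatches c n = count {n} (λ x → c xor even (suc (toℕ x)))

parityMismatches-false : ∀ n → parityMismatches false n ≡ n / 2
parityMismatches-true  : ∀ n → parityMismatches true n ≡ suc n / 2

parityMismatches-false zero    = refl
parityMismatches-false (suc n) = parityMismatches-true n

parityMismatches-true zero    = refl
parityMismatches-true (suc n) = begin
  suc (count {n} (λ x → not (not (even (suc (toℕ x))))))
    ≡⟨ cong suc (count-cong {n} (λ x → not-involutive (even (suc (toℕ x))))) ⟩
  suc (parityMismatches false n)
    ≡⟨ cong suc (parityMismatches-false n) ⟩
  suc (n / 2)
    ≡⟨ [2+n]/2≡1+n/2 n ⟨
  suc (suc n) / 2 ∎
  where open ≡-Reasoning

n/2≤parityMismatches : ∀ c n → n / 2 ≤ parityMismatches c n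
n/2≤parityMismatches false n = ≤-reflexive (sym (parityMismatches-false n))
n/2≤parityMismatches true  n =
  subst (n / 2 ≤_) (sym (parityMismatches-true n)) (/-monoˡ-≤ 2 (n≤1+n n))

-- Index v < h goes to 2v and index h + v to 2v + 1.
interleave : ∀ h → Permutation′ (h * 2)
interleave h =
  ↔-trans (cast-id (*-comm h 2)) (↔-trans (*↔× {2} {h}) (↔-trans (×-comm _ _) (↔-sym (*↔× {h} {2}))))

combine<ᵇ≡even : ∀ {h} (i : Fin 2) (j : Fin h) → (toℕ (combine i j) <ᵇ h) ≡ even (toℕ i)
combine<ᵇ≡even {h} 0F j = trans (cong (_<ᵇ h) (toℕ-↑ˡ j _)) (Equivalence.to T-≡ (<⇒<ᵇ (toℕ<n j)))
combine<ᵇ≡even {h} 1F j = trans (cong (_<ᵇ h) (toℕ-↑ʳ h _)) (m+n<ᵇm≡false h _)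

even-interleave : ∀ h v → even (toℕ (interleave h ⟨$⟩ʳ v)) ≡ (toℕ v <ᵇ h)
even-interleave h v = begin
  even (toℕ (combine r q))  ≡⟨ cong even (trans (toℕ-combine r q) (cong (_+ toℕ q) (*-comm 2 (toℕ r)))) ⟩
  even (toℕ r * 2 + toℕ q)  ≡⟨ even-m*2+n (toℕ r) (toℕ q) ⟩
  even (toℕ q)              ≡⟨ combine<ᵇ≡even q r ⟨
  toℕ (combine q r) <ᵇ h    ≡⟨ cong (λ x → toℕ x <ᵇ h) (combine-remQuot {2} h w) ⟩
  toℕ w <ᵇ h                ≡⟨ cong (_<ᵇ h) (toℕ-cast _ v) ⟩
  toℕ v <ᵇ h                ∎
  where
  open ≡-Reasoning
  w = cast (*-comm h 2) v
  q = proj₁ (remQuot {2} h w)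
  r = proj₂ (remQuot {2} h w)

evenLabel : ∀ {n} → Fin n ⤖ Fin n → Fin n → Bool
evenLabel f v = even (suc (toℕ (Bijection.to f v)))

isNegative≡xor : ∀ {G} (f : Labelling G) u v →
  isNegative {G} f (u , v) ≡ even (label {G} f u) xor even (label {G} f v)
isNegative≡xor {G} f u v with even (label {G} f u) ≟ even (label {G} f v)
... | yes a≡b = sym (trans (cong (_xor _) a≡b) (xor-same (even (label {G} f v))))
... | no  a≢b = sym (trans (cong (_xor _) (¬-not a≢b)) (xor-inverseˡ (even (label {G} f v))))

negCount-wheel : ∀ {k} (f : Labelling (wheel (suc k))) →
  negCount {wheel (suc k)} f ≡
  count (λ i → evenLabel f zero xor evenLabel f (suc i)) + cycleFlips (evenLabel f ∘ suc)
negCount-wheel {k} f = begin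
  length (filter P? (spokes ++ rim))                  ≡⟨ cong length (filter-++ P? spokes rim) ⟩
  length (filter P? spokes ++ filter P? rim)          ≡⟨ length-++ (filter P? spokes) ⟩
  length (filter P? spokes) + length (filter P? rim)  ≡⟨ cong₂ _+_ (negativeEdges _) (negativeEdges _) ⟩
  _                                                   ∎
  where
  open ≡-Reasoning
  G = wheel (suc k)
  P? = λ e → isNegative {G} f e ≟ true
  spokes = map (λ i → (zero , suc i)) (allFin k)
  rim = map (λ i → (suc i , suc (cyc i))) (allFin k)
  negativeEdges : (g : Fin k → Fin (suc k) × Fin (suc k)) →
    length (filter P? (map g (allFin k))) ≡
    count (λ i → evenLabel f (proj₁ (g i)) xor evenLabel f (proj₂ (g i)))
  negativeEdges g = trans (length-filter-map-allFin (isNegative {G} f) g)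
                          (count-cong (λ i → isNegative≡xor {G} f (proj₁ (g i)) (proj₂ (g i))))

spokes≡parityMismatches : ∀ {k} (f : Fin (suc k) ⤖ Fin (suc k)) →
  count (λ i → evenLabel f zero xor evenLabel f (suc i)) ≡ parityMismatches (evenLabel f zero) (suc k)
spokes≡parityMismatches {k} f = begin
  count (λ i → c xor evenLabel f (suc i))
    ≡⟨ cong (λ b → (if b then 1 else 0) + count (λ i → c xor evenLabel f (suc i))) (xor-same c) ⟨
  count (λ v → c xor evenLabel f v)
    ≡⟨ count-permute (⤖⇒↔ f) (λ x → c xor even (suc (toℕ x))) ⟩
  parityMismatches c (suc k) ∎
  where
  open ≡-Reasoning
  c = evenLabel f zero

labelOfParityAvoiding : ∀ {m} b (z : Fin (4 + m)) → ∃ λ y → y ≢ z × even (suc (toℕ y)) ≡ b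
labelOfParityAvoiding false z with z ≟ᶠ 0F
... | yes refl = 2F , (λ ()) , refl
... | no  z≢0  = 0F , z≢0 ∘ sym , refl
labelOfParityAvoiding true  z with z ≟ᶠ 1F
... | yes refl = 3F , (λ ()) , refl
... | no  z≢1  = 1F , z≢1 ∘ sym , refl

rimHasParity : ∀ {m} (f : Labelling (wheel (4 + m))) b → ∃ λ i → evenLabel f (suc i) ≡ b
rimHasParity f b with labelOfParityAvoiding b (Bijection.to f zero)
... | y , y≢centre , evenY≡b with Bijection.strictlySurjective f y
...   | zero  , centre↦y = contradiction (sym centre↦y) y≢centre
...   | suc i , i↦y      = i , trans (cong (λ x → even (suc (toℕ x))) i↦y) evenY≡b

n/2+2≤negCount-wheel : ∀ {m} (f : Labelling (wheel (4 + m))) →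
  (4 + m) / 2 + 2 ≤ negCount {wheel (4 + m)} f
n/2+2≤negCount-wheel {m} f = begin
  (4 + m) / 2 + 2
    ≤⟨ +-mono-≤ (n/2≤parityMismatches c (4 + m)) (2≤cycleFlips Q (proj₂ (rimHasParity f (not (Q zero))))) ⟩
  parityMismatches c (4 + m) + cycleFlips Q
    ≡⟨ cong (_+ cycleFlips Q) (spokes≡parityMismatches f) ⟨
  count (λ i → c xor Q i) + cycleFlips Q
    ≡⟨ negCount-wheel f ⟨
  negCount {wheel (4 + m)} f ∎
  where
  open ≤-Reasoning
  c = evenLabel f zero
  Q = evenLabel f ∘ suc

negCount-wheel≡n/2+2 : ∀ {k} (f : Labelling (wheel (suc k))) →
  evenLabel f zero ≡ false → cycleFlips (evenLabel f ∘ suc) ≡ 2 →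
  negCount {wheel (suc k)} f ≡ suc k / 2 + 2
negCount-wheel≡n/2+2 {k} f centreOdd rimFlips = begin
  negCount {wheel (suc k)} f                             ≡⟨ negCount-wheel f ⟩
  count (λ i → evenLabel f zero xor evenLabel f (suc i)) + cycleFlips (evenLabel f ∘ suc)
                                                         ≡⟨ cong₂ _+_ (spokes≡parityMismatches f) rimFlips ⟩
  parityMismatches (evenLabel f zero) (suc k) + 2        ≡⟨ cong (λ c → parityMismatches c (suc k) + 2) centreOdd ⟩
  parityMismatches false (suc k) + 2                     ≡⟨ cong (_+ 2) (parityMismatches-false (suc k)) ⟩
  suc k / 2 + 2                                          ∎
  where open ≡-Reasoning

optimalLabelling : ∀ m →
  ∃ λ (f : Labelling (wheel (4 + m))) → negCount {wheel (4 + m)} f ≡ (4 + m) / 2 + 2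
optimalLabelling m with halving m
... | evenly h = f , negCount-wheel≡n/2+2 f (cong not (even-interleave (2 + h) zero)) (begin
  cycleFlips {3 + h * 2} (evenLabel f ∘ suc)
    ≡⟨ cycleFlips-cong {3 + h * 2} (λ i → cong not (even-interleave (2 + h) (suc i))) ⟩
  cycleFlips {3 + h * 2} (not ∘ λ i → toℕ i <ᵇ suc h)
    ≡⟨ cycleFlips-not {3 + h * 2} (λ i → toℕ i <ᵇ suc h) ⟩
  cycleFlips {3 + h * 2} (λ i → toℕ i <ᵇ suc h)
    ≡⟨ cycleFlips-threshold (n<2+n*2 h) ⟩
  2 ∎)
  where
  open ≡-Reasoning
  f = ↔⇒⤖ (interleave (2 + h))
... | oddly h = f , negCount-wheel≡n/2+2 f refl (begin
  cycleFlips {4 + h * 2} (evenLabel f ∘ suc)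
    ≡⟨ cycleFlips-cong {4 + h * 2} (λ i → trans (not-involutive _) (even-interleave (2 + h) i)) ⟩
  cycleFlips {4 + h * 2} (λ i → toℕ i <ᵇ suc (suc h))
    ≡⟨ cycleFlips-threshold (s≤s (n<2+n*2 h)) ⟩
  2 ∎)
  where
  open ≡-Reasoning
  f = ↔⇒⤖ (lift₀ (interleave (2 + h)))

theorem12 : (n : ℕ) → 4 ≤ n → IsRna (wheel n) ((n + 4) / 2)
theorem12 n@(suc (suc (suc (suc m)))) (s≤s (s≤s (s≤s (s≤s z≤n)))) =
  subst (IsRna (wheel n)) (sym ([n+4]/2≡n/2+2 n)) (optimalLabelling m , n/2+2≤negCount-wheel)
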